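{- Let $E=(d_1,\ldots,d_{m-1})$ be a valid ordered tuple, $d=d_1+\cdots+d_{m-1}$, $a_0<a_1<\cdots$ the terms of $S_E$, $z$ a positive integer, $R=\{a_0,\ldots,a_z\}$, $\max(R)=a_z$, $c=a_{z+1}$, and suppose: (i) $c=1+d\max(R)-\sum_{k=2}^{m-1}d_k(m-k-1)$; (ii) for every integer $0\le r_1\le c-1$ and every integer $0\le j\le d-2$, there exist $H_j\subseteq\{2,\ldots,m-1\}$ and $r_2,\ldots,r_m\in R$ with $\sum_{k\in H_j}d_k=j$, $\sum_{k=1}^{m-1}d_kr_k=dr_m$, the values $r_k$ ($k\in H_j\cup\{m\}$) pairwise distinct, and the values $r_k$ ($k\in\{2,\ldots,m-1\}\setminus H_j$) pairwise distinct. Let $\mathcal B_E$ be the set of all integers of the form $c\sum_{i\ge0}t_i(d+1)^i+r$ with $t_i\in\{0,1\}$ (finitely many nonzero) and $r\in R$. Then for every nonnegative integer $y_1\notin\mathcal B_E$ there exist distinct $y_2,\ldots,y_m\in\mathcal B_E$, each less than $y_1$, and a permutation $x_1,\ldots,x_m$ of $y_1,\ldots,y_m$ such that $d_1x_1+\cdots+d_{m-1}x_{m-1}=dx_m$.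
   Context: An ordered tuple $E=(d_1,\ldots,d_{m-1})$ of positive integers is written in nondecreasing order; $E$ is valid if $d_1=1$ and $d_l\le d_1+\cdots+d_{l-1}$ for every $2\le l\le m-1$. The sequence $S_E$ is defined greedily: $a_0=0$, and having chosen $a_0,\ldots,a_k$, $a_{k+1}$ is the least integer greater than $a_k$ such that there are no distinct $x_1,\ldots,x_m\in\{a_0,\ldots,a_{k+1}\}$ with $d_1x_1+\cdots+d_{m-1}x_{m-1}=dx_m$. -}

module Defs where

open import Data.Nat using (ℕ; zero; suc; _+_; _*_; _∸_; _≤_; _<_)
open import Data.Fin using (Fin; zero; suc; toℕ; inject₁; fromℕ)
open import Data.Bool using (Bool; true; false; if_then_else_)
open import Data.List using (List; []; _∷_)
open import Data.Product using (Σ; ∃; _×_; _,_)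
open import Data.Sum using (_⊎_)
open import Relation.Nullary using (¬_)
open import Relation.Binary.PropositionalEquality using (_≡_; _≢_)

-- Convention: the tuple E = (d_1, ..., d_{m-1}) has  m - 1 = suc n  entries,
-- i.e. m = n + 2, and is represented as a function  E : Fin (suc n) → ℕ
-- with d_k = E (k-1).  A choice x_1, ..., x_m is a function  Fin (suc (suc n)) → ℕ
-- with x_k = X (inject₁ (k-1)) for k ≤ m-1 and x_m = X (fromℕ (suc n)).

sumF : (n : ℕ) → (Fin n → ℕ) → ℕ
sumF zero    f = 0
sumF (suc n) f = f zero + sumF n (λ i → f (suc i))

dsum : {n : ℕ} → (Fin (suc n) → ℕ) → ℕ
dsum {n} E = sumF (suc n) E

Valid : {n : ℕ} → (Fin (suc n) → ℕ) → Set
Valid {n} E =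
  (∀ i → 1 ≤ E i) ×
  (∀ i j → toℕ i ≤ toℕ j → E i ≤ E j) ×
  (E zero ≡ 1) ×
  (∀ (l : Fin n) → E (suc l) ≤ sumF (toℕ (suc l)) (λ i → E (Data.Fin.inject≤ i (lemma l))))
  where
  open import Data.Fin.Properties using (toℕ<n)
  open import Data.Nat.Properties using (<⇒≤)
  lemma : (l : Fin n) → toℕ (suc l) ≤ suc n
  lemma l = <⇒≤ (toℕ<n (suc l))

Sol : {n : ℕ} → (Fin (suc n) → ℕ) → (Fin (suc (suc n)) → ℕ) → Set
Sol {n} E X = sumF (suc n) (λ i → E i * X (inject₁ i)) ≡ dsum E * X (fromℕ (suc n))

Free : {n : ℕ} → (Fin (suc n) → ℕ) → (ℕ → Set) → Set
Free {n} E P =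
  ¬ (Σ (Fin (suc (suc n)) → ℕ) λ X →
       (∀ i j → X i ≡ X j → i ≡ j) × (∀ i → P (X i)) × Sol E X)

Prefix : (ℕ → ℕ) → ℕ → ℕ → Set
Prefix a k v = ∃ λ i → i ≤ k × a i ≡ v

IsGreedy : {n : ℕ} → (Fin (suc n) → ℕ) → (ℕ → ℕ) → Set
IsGreedy E a =
  (a 0 ≡ 0) ×
  (∀ k → a k < a (suc k)) ×
  (∀ k → Free E (Prefix a (suc k))) ×
  (∀ k b → a k < b → b < a (suc k) → ¬ Free E (λ v → Prefix a k v ⊎ v ≡ b))

digits : ℕ → List Bool → ℕ
digits d []      = 0
digits d (b ∷ t) = (if b then 1 else 0) + (d + 1) * digits d t

InB : (d c : ℕ) → (R : ℕ → Set) → ℕ → Set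
InB d c R v = ∃ λ (t : List Bool) → ∃ λ r → R r × v ≡ c * digits d t + r

-- Σ_{k=2}^{m-1} d_k (m-k-1); index k = i + 2 for i : Fin n, and m-k-1 = n ∸ 1 ∸ i
corr : {n : ℕ} → (Fin (suc n) → ℕ) → ℕ
corr {n} E = sumF n (λ i → E (suc i) * (n ∸ 1 ∸ toℕ i))

-- middle index k = i + 2 (2 ≤ k ≤ m-1) of a choice vector, and the last index m
mid : {n : ℕ} → Fin n → Fin (suc (suc n))
mid i = inject₁ (suc i)

lst : (n : ℕ) → Fin (suc (suc n))
lst n = fromℕ (suc n)

yvec : {n : ℕ} → ℕ → (Fin (suc n) → ℕ) → Fin (suc (suc n)) → ℕ
yvec y₁ ys zero    = y₁
yvec y₁ ys (suc i) = ys i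

module Submission where

open import Defs
open import Data.Nat using (ℕ; zero; suc; _+_; _*_; _≤_; _<_)
open import Data.Fin using (Fin; zero; suc)
open import Data.Fin.Permutation using (Permutation′; _⟨$⟩ʳ_)
open import Data.Bool using (Bool; true; false; if_then_else_)
open import Data.Product using (Σ; ∃; _×_; _,_)
open import Relation.Nullary using (¬_)
open import Relation.Binary.PropositionalEquality using (_≡_; _≢_)

open import Data.Nat using (_∸_; z≤n; s≤s; NonZero; _≤?_; _≟_)
open import Data.Nat.Properties
open import Data.Nat.DivMod using (_/_; _%_; m≡m%n+[m/n]*n; m%n<n; m/n<m)
open import Data.Nat.Induction using (<-rec)
open import Data.Fin using (inject₁; fromℕ)
import Data.Fin.Properties as Fin
open import Data.Fin.Relation.Unary.Top using (view; ‵fromℕ; ‵inject₁)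
open import Data.Fin.Permutation using (_⟨$⟩ˡ_; inverseˡ; inverseʳ; transpose; id)
import Data.Vec.Functional as Vector
open import Data.List using (List; []; _∷_; _++_; map; applyUpTo)
open import Data.List.Properties using (map-++)
open import Data.List.Relation.Unary.All as All using (All; []; _∷_)
open import Data.List.Relation.Unary.All.Properties using (¬Any⇒All¬; ++⁻ˡ; ++⁻ʳ)
open import Data.List.Relation.Unary.Any using (here; there; any?)
open import Data.List.Membership.Propositional using (_∈_; find; lose)
open import Data.List.Membership.Propositional.Properties using (∈-∃++; ∈-applyUpTo⁺; ∈-applyUpTo⁻)
open import Data.Product using (proj₁; proj₂)
open import Data.Sum using (_⊎_; inj₁; inj₂)
open import Data.Empty using (⊥-elim)
open import Relation.Nullary using (Dec; yes; no)
open import Relation.Nullary.Decidable using (_×-dec_; _→-dec_; dec-true)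
open import Relation.Binary.Definitions using (tri<; tri≈; tri>)
open import Relation.Binary.PropositionalEquality
  using (refl; sym; trans; cong; cong₂; subst; module ≡-Reasoning)
open import Algebra.Properties.CommutativeSemigroup +-commutativeSemigroup using (interchange)
open import Algebra.Properties.CommutativeSemigroup *-commutativeSemigroup
  using () renaming (x∙yz≈y∙xz to *-left-comm)

-- Write  y₁ = c·q + r₁  with  r₁ < c = a_{z+1},  and expand q in base d+1 (digits ≤ d).
--
-- (A) All digits of q are 0 or 1, i.e. q = Σ t_i (d+1)^i.  Then y₁ ∉ B forces r₁ ∉ R, so
--     a_k < r₁ < a_{k+1} for some k ≤ z.  The greedy rule rejected r₁, so {a_0,…,a_k,r₁}
--     contains a solution with distinct entries, and it uses r₁.  The equation is
--     translation invariant (both sides have total weight d): adding c·q and moving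
--     r₁ + c·q = y₁ to the front gives y₂,…,y_m of the form c·q + a_i.
-- (B) Some digit v of q is ≥ 2.  A column is a solution (x, g₂,…,g_{m-1}, u) with 0/1
--     entries g_k ≤ u ≤ x.  Every digit x ≤ d heads a column, and at the position of v
--     hypothesis (ii) with j = d − v gives the column (v, 1_H, 1).  Stacking the columns in
--     base d+1 gives a solution (q, D₂,…,D_m), and  c·(q, D₂,…,D_m) + (r₁, r₂,…,r_m)  is a
--     solution with first entry y₁.  Its other entries lie in B, are < y₁ (D_k ≤ D_m < q,
--     strictly at v), and are distinct: the column at v separates H from its complement,
--     and the distinctness conditions of (ii) do the rest.

sumF-cong : ∀ n {f g : Fin n → ℕ} → (∀ i → f i ≡ g i) → sumF n f ≡ sumF n g
sumF-cong zero    f≗g = refl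
sumF-cong (suc n) f≗g = cong₂ _+_ (f≗g zero) (sumF-cong n (λ i → f≗g (suc i)))

sumF-+ : ∀ n (f g : Fin n → ℕ) → sumF n (λ i → f i + g i) ≡ sumF n f + sumF n g
sumF-+ zero    f g = refl
sumF-+ (suc n) f g =
  trans (cong (f zero + g zero +_) (sumF-+ n _ _)) (interchange (f zero) (g zero) _ _)

sumF-*ˡ : ∀ n k (f : Fin n → ℕ) → sumF n (λ i → k * f i) ≡ k * sumF n f
sumF-*ˡ zero    k f = sym (*-zeroʳ k)
sumF-*ˡ (suc n) k f =
  trans (cong (k * f zero +_) (sumF-*ˡ n k _)) (sym (*-distribˡ-+ k (f zero) _))

horner : ℕ → List ℕ → ℕ
horner b []       = 0
horner b (x ∷ xs) = x + b * horner b xs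

module _ {n : ℕ} (E : Fin (suc n) → ℕ) where
  open ≡-Reasoning

  Sol-cong : ∀ {X Y} → Sol E X → (∀ i → X i ≡ Y i) → Sol E Y
  Sol-cong sol X≗Y =
    trans (sumF-cong (suc n) (λ i → cong (E i *_) (sym (X≗Y (inject₁ i)))))
          (trans sol (cong (dsum E *_) (X≗Y _)))

  Sol-+ : ∀ X Y → Sol E X → Sol E Y → Sol E (λ i → X i + Y i)
  Sol-+ X Y solX solY = begin
      sumF (suc n) (λ i → E i * (X (inject₁ i) + Y (inject₁ i)))
    ≡⟨ sumF-cong (suc n) (λ i → *-distribˡ-+ (E i) (X (inject₁ i)) (Y (inject₁ i))) ⟩
      sumF (suc n) (λ i → E i * X (inject₁ i) + E i * Y (inject₁ i))
    ≡⟨ sumF-+ (suc n) (λ i → E i * X (inject₁ i)) (λ i → E i * Y (inject₁ i)) ⟩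
      sumF (suc n) (λ i → E i * X (inject₁ i)) + sumF (suc n) (λ i → E i * Y (inject₁ i))
    ≡⟨ cong₂ _+_ solX solY ⟩
      dsum E * X (fromℕ (suc n)) + dsum E * Y (fromℕ (suc n))
    ≡⟨ sym (*-distribˡ-+ (dsum E) _ _) ⟩
      dsum E * (X (fromℕ (suc n)) + Y (fromℕ (suc n))) ∎

  Sol-scale : ∀ k X → Sol E X → Sol E (λ i → k * X i)
  Sol-scale k X sol = begin
      sumF (suc n) (λ i → E i * (k * X (inject₁ i)))
    ≡⟨ sumF-cong (suc n) (λ i → *-left-comm (E i) k (X (inject₁ i))) ⟩
      sumF (suc n) (λ i → k * (E i * X (inject₁ i)))
    ≡⟨ sumF-*ˡ (suc n) k (λ i → E i * X (inject₁ i)) ⟩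
      k * sumF (suc n) (λ i → E i * X (inject₁ i))
    ≡⟨ cong (k *_) sol ⟩
      k * (dsum E * X (fromℕ (suc n)))
    ≡⟨ *-left-comm k (dsum E) _ ⟩
      dsum E * (k * X (fromℕ (suc n))) ∎

  Sol-const : ∀ t → Sol E (λ _ → t)
  Sol-const t = begin
      sumF (suc n) (λ i → E i * t)  ≡⟨ sumF-cong (suc n) (λ i → *-comm (E i) t) ⟩
      sumF (suc n) (λ i → t * E i)  ≡⟨ sumF-*ˡ (suc n) t E ⟩
      t * dsum E                    ≡⟨ *-comm t (dsum E) ⟩
      dsum E * t                    ∎

  Sol-translate : ∀ t X → Sol E X → Sol E (λ i → X i + t)
  Sol-translate t X sol = Sol-+ X (λ _ → t) sol (Sol-const t)

  Sol-horner : ∀ {A : Set} b (X : A → Fin (suc (suc n)) → ℕ) → (∀ x → Sol E (X x)) →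
    ∀ xs → Sol E (λ i → horner b (map (λ x → X x i) xs))
  Sol-horner b X sols []       = Sol-const 0
  Sol-horner b X sols (x ∷ xs) =
    Sol-+ (X x) (λ i → b * horner b (map (λ y → X y i) xs)) (sols x)
      (Sol-scale b (λ i → horner b (map (λ y → X y i) xs)) (Sol-horner b X sols xs))

quotRem-< : ∀ c {a b r r'} → r < c → a < b → c * a + r < c * b + r'
quotRem-< c {a} {b} {r} {r'} r<c a<b = begin-strict
  c * a + r   <⟨ +-monoʳ-< (c * a) r<c ⟩
  c * a + c   ≡⟨ +-comm (c * a) c ⟩
  c + c * a   ≡⟨ sym (*-suc c a) ⟩
  c * suc a   ≤⟨ *-monoʳ-≤ c a<b ⟩
  c * b       ≤⟨ m≤m+n (c * b) r' ⟩
  c * b + r'  ∎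
  where open ≤-Reasoning

quotRem-unique : ∀ c {a a' r r'} → r < c → r' < c → c * a + r ≡ c * a' + r' → a ≡ a' × r ≡ r'
quotRem-unique c {a} {a'} r<c r'<c eq with <-cmp a a'
... | tri< a<a' _ _ = ⊥-elim (<-irrefl eq (quotRem-< c r<c a<a'))
... | tri≈ _ refl _ = refl , +-cancelˡ-≡ (c * a) _ _ eq
... | tri> _ _ a'<a = ⊥-elim (<-irrefl (sym eq) (quotRem-< c r'<c a'<a))

divide : ∀ y c → 0 < c → Σ ℕ λ q → Σ ℕ λ r → r < c × y ≡ c * q + r
divide y (suc c) _ =
  y / suc c , y % suc c , m%n<n y (suc c) ,
  trans (m≡m%n+[m/n]*n y (suc c)) (trans (+-comm (y % suc c) _) (cong (_+ y % suc c) (*-comm (y / suc c) (suc c))))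

bit : Bool → ℕ
bit b = if b then 1 else 0

bit≤1 : ∀ b → bit b ≤ 1
bit≤1 true  = s≤s z≤n
bit≤1 false = z≤n

bit-injective : ∀ x y → bit x ≡ bit y → x ≡ y
bit-injective true  true  _ = refl
bit-injective false false _ = refl

digits-map : ∀ {A : Set} d (h : A → Bool) xs →
  digits d (map h xs) ≡ horner (suc d) (map (λ x → bit (h x)) xs)
digits-map d h []       = refl
digits-map d h (x ∷ xs) = cong₂ (λ b v → bit (h x) + b * v) (+-comm d 1) (digits-map d h xs)

horner-mono : ∀ b {A : Set} (f g : A → ℕ) → (∀ x → f x ≤ g x) →
  ∀ xs → horner b (map f xs) ≤ horner b (map g xs)
horner-mono b f g f≤g []       = z≤n
horner-mono b f g f≤g (x ∷ xs) = +-mono-≤ (f≤g x) (*-monoʳ-≤ b (horner-mono b f g f≤g xs))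

horner-strict : ∀ b .{{_ : NonZero b}} {A : Set} (f g : A → ℕ) → (∀ x → f x ≤ g x) →
  ∀ xs x ys → f x < g x → horner b (map f (xs ++ x ∷ ys)) < horner b (map g (xs ++ x ∷ ys))
horner-strict b f g f≤g []        x ys fx<gx = +-mono-<-≤ fx<gx (*-monoʳ-≤ b (horner-mono b f g f≤g ys))
horner-strict b f g f≤g (x' ∷ xs) x ys fx<gx =
  +-mono-≤-< (f≤g x') (*-monoʳ-< b (horner-strict b f g f≤g xs x ys fx<gx))

split-first-bit : ∀ d → 1 ≤ d → ∀ {x y u v} → bit x + suc d * u ≡ bit y + suc d * v → x ≡ y × u ≡ v
split-first-bit d 1≤d {x} {y} {u} {v} eq with
  quotRem-unique (suc d) (bit<base x) (bit<base y) (trans (+-comm (suc d * u) (bit x)) (trans eq (+-comm (bit y) _)))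
  where
  bit<base : ∀ b → bit b < suc d
  bit<base b = s≤s (≤-trans (bit≤1 b) 1≤d)
... | u≡v , x≡y = bit-injective x y x≡y , u≡v

bits-agree-at : ∀ d → 1 ≤ d → {A : Set} (h₁ h₂ : A → Bool) → ∀ xs x ys →
  horner (suc d) (map (λ y → bit (h₁ y)) (xs ++ x ∷ ys)) ≡
    horner (suc d) (map (λ y → bit (h₂ y)) (xs ++ x ∷ ys)) →
  h₁ x ≡ h₂ x
bits-agree-at d 1≤d h₁ h₂ []        x ys eq = proj₁ (split-first-bit d 1≤d {h₁ x} {h₂ x} eq)
bits-agree-at d 1≤d h₁ h₂ (x' ∷ xs) x ys eq =
  bits-agree-at d 1≤d h₁ h₂ xs x ys (proj₂ (split-first-bit d 1≤d {h₁ x'} {h₂ x'} eq))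

expansion : ∀ d → 1 ≤ d → ∀ q → Σ (List ℕ) λ ds → All (_≤ d) ds × horner (suc d) ds ≡ q
expansion d 1≤d = <-rec Expansion step
  where
  Expansion : ℕ → Set
  Expansion q = Σ (List ℕ) λ ds → All (_≤ d) ds × horner (suc d) ds ≡ q
  step : ∀ q → (∀ {p} → p < q → Expansion p) → Expansion q
  step zero      _   = [] , [] , refl
  step q@(suc _) rec with rec (m/n<m q (suc d) (s≤s 1≤d))
  ... | ds , ds≤d , value =
    q % suc d ∷ ds , ≤-pred (m%n<n q (suc d)) ∷ ds≤d ,
    (begin
      q % suc d + suc d * horner (suc d) ds  ≡⟨ cong (λ h → q % suc d + suc d * h) value ⟩
      q % suc d + suc d * (q / suc d)        ≡⟨ cong (q % suc d +_) (*-comm (suc d) (q / suc d)) ⟩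
      q % suc d + q / suc d * suc d          ≡⟨ sym (m≡m%n+[m/n]*n q (suc d)) ⟩
      q                                      ∎)
    where open ≡-Reasoning

LargeDigit : List ℕ → Set
LargeDigit ds = Σ (List ℕ) λ ds₁ → Σ ℕ λ v → Σ (List ℕ) λ ds₂ → 2 ≤ v × ds ≡ ds₁ ++ v ∷ ds₂

binary-digits : ∀ d ds → All (_≤ 1) ds → Σ (List Bool) λ t → horner (suc d) ds ≡ digits d t
binary-digits d []                []      = [] , refl
binary-digits d (zero ∷ ds)       (_ ∷ p) with binary-digits d ds p
... | t , value = false ∷ t , cong₂ (λ b h → 0 + b * h) (sym (+-comm d 1)) value
binary-digits d (suc zero ∷ ds)   (_ ∷ p) with binary-digits d ds p
... | t , value = true ∷ t , cong₂ (λ b h → 1 + b * h) (sym (+-comm d 1)) value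
binary-digits d (suc (suc _) ∷ _) (s≤s () ∷ _)

binary-or-large : ∀ d ds → (Σ (List Bool) λ t → horner (suc d) ds ≡ digits d t) ⊎ LargeDigit ds
binary-or-large d ds with any? (2 ≤?_) ds
... | yes large with find large
...   | v , v∈ds , 2≤v with ∈-∃++ v∈ds
...     | ds₁ , ds₂ , split = inj₂ (ds₁ , v , ds₂ , 2≤v , split)
binary-or-large d ds | no ¬large =
  inj₁ (binary-digits d ds (All.map (λ 2≰x → ≤-pred (≰⇒> 2≰x)) (¬Any⇒All¬ ds ¬large)))

Distinct : ∀ {N} → (Fin N → ℕ) → Set
Distinct X = ∀ i k → X i ≡ X k → i ≡ k

module Reorder {N : ℕ} (σ : Permutation′ (suc (suc N))) (X : Fin (suc (suc N)) → ℕ) where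

  front : ℕ
  front = X (σ ⟨$⟩ˡ zero)

  rest : Fin (suc N) → ℕ
  rest j = X (σ ⟨$⟩ˡ suc j)

  reindex : ∀ i → X i ≡ yvec front rest (σ ⟨$⟩ʳ i)
  reindex i with σ ⟨$⟩ʳ i in σi
  ... | zero  = cong X (sym (trans (cong (σ ⟨$⟩ˡ_) (sym σi)) (inverseˡ σ)))
  ... | suc j = cong X (sym (trans (cong (σ ⟨$⟩ˡ_) (sym σi)) (inverseˡ σ)))

  private
    σ⁻¹-injective : ∀ {i k} → σ ⟨$⟩ˡ i ≡ σ ⟨$⟩ˡ k → i ≡ k
    σ⁻¹-injective e = trans (sym (inverseʳ σ)) (trans (cong (σ ⟨$⟩ʳ_) e) (inverseʳ σ))

  rest-distinct : Distinct X → Distinct rest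
  rest-distinct distinct j k e = Fin.suc-injective (σ⁻¹-injective (distinct _ _ e))

  rest-avoids-front : Distinct X → ∀ j → rest j ≢ front
  rest-avoids-front distinct j e with σ⁻¹-injective (distinct _ _ e)
  ... | ()

front-transpose : ∀ {N} (p : Fin (suc (suc N))) X → Reorder.front (transpose p zero) X ≡ X p
front-transpose {N} p X rewrite dec-true (zero {suc N} Fin.≟ zero) refl = refl

searchVectors : ∀ N (L : List ℕ) (Q : (Fin N → ℕ) → Set) →
  (∀ {X Y} → (∀ i → X i ≡ Y i) → Q X → Q Y) → (∀ X → Dec (Q X)) →
  Dec (Σ (Fin N → ℕ) λ X → (∀ i → X i ∈ L) × Q X)
searchVectors zero L Q resp dec with dec (λ ())
... | yes q  = yes ((λ ()) , (λ ()) , q)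
... | no  ¬q = no λ (X , _ , qX) → ¬q (resp (λ ()) qX)
searchVectors (suc N) L Q resp dec with any? extendable L
  where
  extendable : ∀ x → Dec (Σ (Fin N → ℕ) λ X → (∀ i → X i ∈ L) × Q (x Vector.∷ X))
  extendable x = searchVectors N L (λ X → Q (x Vector.∷ X))
    (λ X≗Y → resp (λ { zero → refl ; (suc i) → X≗Y i })) (λ X → dec (x Vector.∷ X))
... | yes found with find found
...   | x , x∈L , X , X∈L , qX = yes ((x Vector.∷ X) , (λ { zero → x∈L ; (suc i) → X∈L i }) , qX)
searchVectors (suc N) L Q resp dec | no none =
  no λ (X , X∈L , qX) →
    none (lose (X∈L zero) (Vector.tail X , (λ i → X∈L (suc i)) , resp (λ { zero → refl ; (suc i) → refl }) qX))

module Increasing (a : ℕ → ℕ) (increasing : ∀ k → a k < a (suc k)) where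

  monotone : ∀ {i} k → i ≤ k → a i ≤ a k
  monotone zero    z≤n = ≤-refl
  monotone (suc k) i≤k with m≤n⇒m<n∨m≡n i≤k
  ... | inj₁ i<k  = ≤-trans (monotone k (≤-pred i<k)) (<⇒≤ (increasing k))
  ... | inj₂ refl = ≤-refl

  prefix-≤ : ∀ {k v} → Prefix a k v → v ≤ a k
  prefix-≤ {k} (i , i≤k , refl) = monotone k i≤k

  prefix-< : ∀ {k v} → Prefix a k v → v < a (suc k)
  prefix-< {k} p = ≤-<-trans (prefix-≤ p) (increasing k)

  prefix-weaken : ∀ {k k' v} → k ≤ k' → Prefix a k v → Prefix a k' v
  prefix-weaken k≤k' (i , i≤k , e) = i , ≤-trans i≤k k≤k' , e

  locate : a 0 ≡ 0 → ∀ z {r} → r < a (suc z) →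
    Prefix a z r ⊎ Σ ℕ λ k → k ≤ z × a k < r × r < a (suc k)
  locate a0≡0 zero {r} r<a₁ with <-cmp r (a 0)
  ... | tri< r<a₀ _ _ = ⊥-elim (n≮0 (subst (r <_) a0≡0 r<a₀))
  ... | tri≈ _ r≡a₀ _ = inj₁ (0 , z≤n , sym r≡a₀)
  ... | tri> _ _ a₀<r = inj₂ (0 , z≤n , a₀<r , r<a₁)
  locate a0≡0 (suc z) {r} r<a with <-cmp r (a (suc z))
  ... | tri≈ _ r≡a _ = inj₁ (suc z , ≤-refl , sym r≡a)
  ... | tri> _ _ a<r = inj₂ (suc z , ≤-refl , a<r , r<a)
  ... | tri< r<a' _ _ with locate a0≡0 z r<a'
  ...   | inj₁ p                    = inj₁ (prefix-weaken (n≤1+n z) p)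
  ...   | inj₂ (k , k≤z , gap)      = inj₂ (k , ≤-trans k≤z (n≤1+n z) , gap)

  prefix-∈ : ∀ {k v} → Prefix a k v → v ∈ applyUpTo a (suc k)
  prefix-∈ (i , i≤k , refl) = ∈-applyUpTo⁺ a (s≤s i≤k)

  ∈-prefix : ∀ {k v} → v ∈ applyUpTo a (suc k) → Prefix a k v
  ∈-prefix v∈ with ∈-applyUpTo⁻ a v∈
  ... | i , i<1+k , v≡aᵢ = i , ≤-pred i<1+k , sym v≡aᵢ

Completion : (n : ℕ) → (Fin (suc n) → ℕ) → (ℕ → Set) → ℕ → Set
Completion n E B y₁ =
  Σ (Fin (suc n) → ℕ) λ ys → Distinct ys × (∀ i → B (ys i)) × (∀ i → ys i < y₁) ×
    Σ (Permutation′ (suc (suc n))) λ σ → Sol E (λ i → yvec y₁ ys (σ ⟨$⟩ʳ i))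

module Gap {n : ℕ} (E : Fin (suc n) → ℕ) (a : ℕ → ℕ) (greedy : IsGreedy E a) where
  open Increasing a (proj₁ (proj₂ greedy))

  private
    prefix-free : ∀ k → Free E (Prefix a (suc k))
    prefix-free = proj₁ (proj₂ (proj₂ greedy))

    rejected : ∀ k b → a k < b → b < a (suc k) → ¬ Free E (λ v → Prefix a k v ⊎ v ≡ b)
    rejected = proj₂ (proj₂ (proj₂ greedy))

    Candidate : (Fin (suc (suc n)) → ℕ) → Set
    Candidate X = Distinct X × Sol E X

    candidate-resp : ∀ {X Y} → (∀ i → X i ≡ Y i) → Candidate X → Candidate Y
    candidate-resp X≗Y (distinct , sol) =
      (λ i k e → distinct i k (trans (X≗Y i) (trans e (sym (X≗Y k))))) , Sol-cong E sol X≗Y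

    candidate? : ∀ X → Dec (Candidate X)
    candidate? X =
      (Fin.all? λ i → Fin.all? λ k → (X i ≟ X k) →-dec (i Fin.≟ k)) ×-dec (_ ≟ _)

    to-list : ∀ {k b v} → Prefix a k v ⊎ v ≡ b → v ∈ b ∷ applyUpTo a (suc k)
    to-list (inj₁ p)   = there (prefix-∈ p)
    to-list (inj₂ v≡b) = here v≡b

    from-list : ∀ {k b v} → v ∈ b ∷ applyUpTo a (suc k) → v ≡ b ⊎ Prefix a k v
    from-list (here v≡b) = inj₁ v≡b
    from-list (there v∈) = inj₂ (∈-prefix v∈)

  -- The greedy rule rejected a_k < b < a_{k+1}, so {a_0,…,a_k,b} contains a solution with
  -- distinct entries; it uses b, because {a_0,…,a_{k+1}} contains none.
  gapSolution : ∀ k {b} → a k < b → b < a (suc k) →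
    Σ (Fin (suc (suc n)) → ℕ) λ X → Distinct X × Sol E X ×
      Σ (Fin (suc (suc n))) λ p → X p ≡ b × (∀ i → X i ≡ b ⊎ Prefix a k (X i))
  gapSolution k {b} aₖ<b b<aₖ₊₁
    with searchVectors (suc (suc n)) (b ∷ applyUpTo a (suc k)) Candidate candidate-resp candidate?
  ... | no none =
    ⊥-elim (rejected k b aₖ<b b<aₖ₊₁
      λ (X , distinct , X∈ , sol) → none (X , (λ i → to-list (X∈ i)) , distinct , sol))
  ... | yes (X , X∈L , distinct , sol) with Fin.any? (λ i → X i ≟ b)
  ...   | yes (p , Xp≡b) = X , distinct , sol , p , Xp≡b , (λ i → from-list (X∈L i))
  ...   | no  b∉X        = ⊥-elim (prefix-free k (X , distinct , old , sol))
    where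
    old : ∀ i → Prefix a (suc k) (X i)
    old i with from-list {k} (X∈L i)
    ... | inj₁ Xi≡b = ⊥-elim (b∉X (i , Xi≡b))
    ... | inj₂ p    = prefix-weaken (n≤1+n k) p

  -- Translating that solution by s = c·Σ t_i (d+1)^i and moving b + s = y₁ to the front.
  gapCompletion : ∀ z k → k ≤ z → ∀ {r₁} → a k < r₁ → r₁ < a (suc k) →
    ∀ d c t {y₁} → y₁ ≡ c * digits d t + r₁ → Completion n E (InB d c (Prefix a z)) y₁
  gapCompletion z k k≤z {r₁} aₖ<r₁ r₁<aₖ₊₁ d c t {y₁} y₁≡ with gapSolution k aₖ<r₁ r₁<aₖ₊₁
  ... | X , distinct , sol , p , Xp≡r₁ , entries =
    rest , rest-distinct shifted-distinct , in-B , below ,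
    σ , subst (λ f → Sol E (λ i → yvec f rest (σ ⟨$⟩ʳ i))) front≡y₁ (Sol-cong E (Sol-translate E s X sol) reindex)
    where
    s : ℕ
    s = c * digits d t
    σ : Permutation′ (suc (suc n))
    σ = transpose p zero
    open Reorder σ (λ i → X i + s)

    shifted-distinct : Distinct (λ i → X i + s)
    shifted-distinct i k e = distinct i k (+-cancelʳ-≡ s _ _ e)

    y₁≡r₁+s : y₁ ≡ r₁ + s
    y₁≡r₁+s = trans y₁≡ (+-comm s r₁)

    front≡y₁ : front ≡ y₁
    front≡y₁ = trans (front-transpose p (λ i → X i + s)) (trans (cong (_+ s) Xp≡r₁) (sym y₁≡r₁+s))

    old : ∀ j → Prefix a k (X (σ ⟨$⟩ˡ suc j))
    old j with entries (σ ⟨$⟩ˡ suc j)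
    ... | inj₁ e = ⊥-elim (rest-avoids-front shifted-distinct j
                     (trans (cong (_+ s) (trans e (sym Xp≡r₁))) (sym (front-transpose p (λ i → X i + s)))))
    ... | inj₂ p = p

    in-B : ∀ j → InB d c (Prefix a z) (rest j)
    in-B j = t , X (σ ⟨$⟩ˡ suc j) , prefix-weaken k≤z (old j) , +-comm _ s

    below : ∀ j → rest j < y₁
    below j = subst (rest j <_) (sym y₁≡r₁+s) (+-monoˡ-< s (≤-<-trans (prefix-≤ (old j)) aₖ<r₁))

snoc : ∀ {n} {A : Set} → (Fin n → A) → A → Fin (suc n) → A
snoc {zero}  f x zero    = x
snoc {suc n} f x zero    = f zero
snoc {suc n} f x (suc k) = snoc (λ i → f (suc i)) x k

snoc-inject₁ : ∀ {n} {A : Set} (f : Fin n → A) x i → snoc f x (inject₁ i) ≡ f i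
snoc-inject₁ {suc n} f x zero    = refl
snoc-inject₁ {suc n} f x (suc i) = snoc-inject₁ (λ i → f (suc i)) x i

snoc-last : ∀ {n} {A : Set} (f : Fin n → A) x → snoc f x (fromℕ n) ≡ x
snoc-last {zero}  f x = refl
snoc-last {suc n} f x = snoc-last (λ i → f (suc i)) x

selectSum : ∀ {n} → (Fin (suc n) → ℕ) → (Fin n → Bool) → ℕ
selectSum {n} E G = sumF n (λ i → if G i then E (suc i) else 0)

-- The data hypothesis (ii) provides for r₁ and j.
Partition : (n : ℕ) → (Fin (suc n) → ℕ) → (ℕ → Set) → ℕ → ℕ → Set
Partition n E R r₁ j =
  Σ (Fin n → Bool) λ H → Σ (Fin (suc (suc n)) → ℕ) λ r →
    (r zero ≡ r₁) ×
    (∀ i → R (r (mid i))) × R (r (lst n)) ×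
    (selectSum E H ≡ j) ×
    Sol E r ×
    (∀ i k → H i ≡ true → H k ≡ true → r (mid i) ≡ r (mid k) → i ≡ k) ×
    (∀ i → H i ≡ true → r (mid i) ≢ r (lst n)) ×
    (∀ i k → H i ≡ false → H k ≡ false → r (mid i) ≡ r (mid k) → i ≡ k)

-- The distinctness conditions of (ii) say that the positions 2,…,m are told apart by the
-- pair (label, r), where the label is H on 2,…,m-1 and true at m.
label-separates : ∀ {n} (H : Fin n → Bool) (r : Fin (suc n) → ℕ) →
  (∀ i k → H i ≡ true → H k ≡ true → r (inject₁ i) ≡ r (inject₁ k) → i ≡ k) →
  (∀ i → H i ≡ true → r (inject₁ i) ≢ r (fromℕ n)) →
  (∀ i k → H i ≡ false → H k ≡ false → r (inject₁ i) ≡ r (inject₁ k) → i ≡ k) →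
  ∀ k k' → snoc H true k ≡ snoc H true k' → r k ≡ r k' → k ≡ k'
label-separates H r sep-H sep-H-last sep-rest k k' label≡ r≡ with view k | view k'
... | ‵fromℕ      | ‵fromℕ       = refl
... | ‵inject₁ i  | ‵fromℕ       =
  ⊥-elim (sep-H-last i (trans (sym (snoc-inject₁ H true i)) (trans label≡ (snoc-last H true))) r≡)
... | ‵fromℕ      | ‵inject₁ i   =
  ⊥-elim (sep-H-last i (trans (sym (snoc-inject₁ H true i)) (trans (sym label≡) (snoc-last H true))) (sym r≡))
... | ‵inject₁ i  | ‵inject₁ i'  = cong inject₁ (same-label (H i) refl)
  where
  Hi≡Hi' : H i ≡ H i'
  Hi≡Hi' = trans (sym (snoc-inject₁ H true i)) (trans label≡ (snoc-inject₁ H true i'))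
  same-label : ∀ b → H i ≡ b → i ≡ i'
  same-label true  Hi = sep-H    i i' Hi (trans (sym Hi≡Hi') Hi) r≡
  same-label false Hi = sep-rest i i' Hi (trans (sym Hi≡Hi') Hi) r≡

weight-positive : ∀ {n} (E : Fin (suc n) → ℕ) → E zero ≡ 1 → 1 ≤ dsum E
weight-positive E E₀≡1 = subst (_≤ dsum E) E₀≡1 (m≤m+n (E zero) _)

module Columns {n : ℕ} (E : Fin (suc n) → ℕ) (E₀≡1 : E zero ≡ 1)
  (subsetSums : ∀ w → w < dsum E → Σ (Fin n → Bool) λ G → selectSum E G ≡ w) where

  d : ℕ
  d = dsum E

  1≤d : 1 ≤ d
  1≤d = weight-positive E E₀≡1

  record Column : Set where
    field
      digit     : ℕ
      entry     : Fin (suc n) → Bool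
      solves    : Sol E (yvec digit (λ k → bit (entry k)))
      entry≤top : ∀ k → bit (entry k) ≤ bit (entry (fromℕ n))
      top≤digit : bit (entry (fromℕ n)) ≤ digit
  open Column

  zeroColumn : Column
  zeroColumn = record
    { digit     = 0
    ; entry     = λ _ → false
    ; solves    = Sol-cong E {λ _ → 0} {yvec 0 (λ _ → 0)} (Sol-const E 0) (λ { zero → refl ; (suc k) → refl })
    ; entry≤top = λ _ → z≤n
    ; top≤digit = z≤n
    }

  fullColumn : ∀ x → 1 ≤ x → (G : Fin n → Bool) → x + selectSum E G ≡ d → Column
  fullColumn x 1≤x G balance = record
    { digit     = x
    ; entry     = snoc G true
    ; solves    = balanced
    ; entry≤top = λ k → subst (bit (snoc G true k) ≤_) top≡1 (bit≤1 _)
    ; top≤digit = subst (_≤ x) top≡1 1≤x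
    }
    where
    open ≡-Reasoning
    top≡1 : 1 ≡ bit (snoc G true (fromℕ n))
    top≡1 = cong bit (sym (snoc-last G true))
    select-bit : ∀ b e → e * bit b ≡ (if b then e else 0)
    select-bit true  e = *-identityʳ e
    select-bit false e = *-zeroʳ e
    balanced : Sol E (yvec x (λ k → bit (snoc G true k)))
    balanced = begin
        E zero * x + sumF n (λ i → E (suc i) * bit (snoc G true (inject₁ i)))
      ≡⟨ cong₂ _+_ (trans (cong (_* x) E₀≡1) (*-identityˡ x))
                   (sumF-cong n λ i → trans (cong (λ b → E (suc i) * bit b) (snoc-inject₁ G true i))
                                            (select-bit (G i) (E (suc i)))) ⟩
        x + selectSum E G
      ≡⟨ balance ⟩
        d
      ≡⟨ sym (*-identityʳ d) ⟩
        d * 1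
      ≡⟨ cong (d *_) top≡1 ⟩
        d * bit (snoc G true (fromℕ n)) ∎

  digitColumn : ∀ x → x ≤ d → Column
  digitColumn zero    _   = zeroColumn
  digitColumn (suc x) x≤d = fullColumn (suc x) (s≤s z≤n) (proj₁ complement)
    (trans (cong (suc x +_) (proj₂ complement)) (m+[n∸m]≡n x≤d))
    where
    complement : Σ (Fin n → Bool) λ G → selectSum E G ≡ d ∸ suc x
    complement = subsetSums (d ∸ suc x) (∸-monoʳ-< {d} {suc x} {0} (s≤s z≤n) x≤d)

  columnsOf : ∀ ds → All (_≤ d) ds → List Column
  columnsOf []       []           = []
  columnsOf (x ∷ ds) (x≤d ∷ ds≤d) = digitColumn x x≤d ∷ columnsOf ds ds≤d

  digits-columnsOf : ∀ ds ds≤d → map digit (columnsOf ds ds≤d) ≡ ds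
  digits-columnsOf []       []                 = refl
  digits-columnsOf (zero  ∷ ds) (_ ∷ ds≤d)     = cong (zero ∷_) (digits-columnsOf ds ds≤d)
  digits-columnsOf (suc x ∷ ds) (_ ∷ ds≤d)     = cong (suc x ∷_) (digits-columnsOf ds ds≤d)

  stack : List Column → Fin (suc (suc n)) → ℕ
  stack cols i = horner (suc d) (map (λ col → yvec (digit col) (λ k → bit (entry col k)) i) cols)

  row : List Column → Fin (suc n) → List Bool
  row cols k = map (λ col → entry col k) cols

  stack-solves : ∀ cols → Sol E (stack cols)
  stack-solves = Sol-horner E (suc d) (λ col → yvec (digit col) (λ k → bit (entry col k))) solves

  stack-row : ∀ cols k → stack cols (suc k) ≡ digits d (row cols k)
  stack-row cols k = sym (digits-map d (λ col → entry col k) cols)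

  row-below : ∀ cols₁ col cols₂ → bit (entry col (fromℕ n)) < digit col → ∀ k →
    digits d (row (cols₁ ++ col ∷ cols₂) k) < horner (suc d) (map digit (cols₁ ++ col ∷ cols₂))
  row-below cols₁ col cols₂ u<x k = begin-strict
      digits d (row cols k)
    ≡⟨ digits-map d (λ c → entry c k) cols ⟩
      horner (suc d) (map (λ c → bit (entry c k)) cols)
    ≤⟨ horner-mono (suc d) _ _ (λ c → entry≤top c k) cols ⟩
      horner (suc d) (map (λ c → bit (entry c (fromℕ n))) cols)
    <⟨ horner-strict (suc d) _ _ top≤digit cols₁ col cols₂ u<x ⟩
      horner (suc d) (map digit cols) ∎
    where
    open ≤-Reasoning
    cols = cols₁ ++ col ∷ cols₂

  rows-agree-at : ∀ cols₁ col cols₂ {k k'} →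
    digits d (row (cols₁ ++ col ∷ cols₂) k) ≡ digits d (row (cols₁ ++ col ∷ cols₂) k') →
    entry col k ≡ entry col k'
  rows-agree-at cols₁ col cols₂ {k} {k'} eq =
    bits-agree-at d 1≤d (λ c → entry c k) (λ c → entry c k') cols₁ col cols₂
      (trans (sym (digits-map d (λ c → entry c k) cols)) (trans eq (digits-map d (λ c → entry c k') cols)))
    where cols = cols₁ ++ col ∷ cols₂

  -- Case (B): q has a digit v ≥ 2.  With (H, r) from (ii) for j = d − v, the column (v, 1_H, 1)
  -- at the position of v and digit columns elsewhere give  y = c·stack + r.
  largeDigitCompletion : (R : ℕ → Set) (c : ℕ) → (∀ {v} → R v → v < c) →
    ∀ {y₁ q r₁} → y₁ ≡ c * q + r₁ → r₁ < c →
    ∀ ds → All (_≤ d) ds → horner (suc d) ds ≡ q → LargeDigit ds →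
    (∀ j → j + 2 ≤ d → Partition n E R r₁ j) →
    Completion n E (InB d c R) y₁
  largeDigitCompletion R c R<c {y₁} {q} {r₁} y₁≡ r₁<c ds ds≤d ds≡q (ds₁ , v , ds₂ , 2≤v , split) partition =
    assemble (partition (d ∸ v) room)
    where
    bounds : All (_≤ d) (ds₁ ++ v ∷ ds₂)
    bounds = subst (All (_≤ d)) split ds≤d
    v≤d : v ≤ d
    v≤d = All.head (++⁻ʳ ds₁ bounds)
    room : d ∸ v + 2 ≤ d
    room = ≤-trans (+-monoʳ-≤ (d ∸ v) 2≤v) (≤-reflexive (trans (+-comm (d ∸ v) v) (m+[n∸m]≡n v≤d)))

    assemble : Partition n E R r₁ (d ∸ v) → Completion n E (InB d c R) y₁
    assemble (H , r , r₀≡r₁ , r-mid , r-last , H-sum , r-solves , sep-H , sep-H-last , sep-rest) =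
      ys , distinct , in-B , below , id , Sol-cong E y-solves combine
      where
      special : Column
      special = fullColumn v (≤-trans (s≤s z≤n) 2≤v) H (trans (cong (v +_) H-sum) (m+[n∸m]≡n v≤d))
      cols₁ cols₂ cols : List Column
      cols₁ = columnsOf ds₁ (++⁻ˡ ds₁ bounds)
      cols₂ = columnsOf ds₂ (All.tail (++⁻ʳ ds₁ bounds))
      cols  = cols₁ ++ special ∷ cols₂

      first≡q : horner (suc d) (map digit cols) ≡ q
      first≡q = begin
          horner (suc d) (map digit cols)
        ≡⟨ cong (horner (suc d)) (map-++ digit cols₁ (special ∷ cols₂)) ⟩
          horner (suc d) (map digit cols₁ ++ v ∷ map digit cols₂)
        ≡⟨ cong₂ (λ xs ys → horner (suc d) (xs ++ v ∷ ys)) (digits-columnsOf ds₁ _) (digits-columnsOf ds₂ _) ⟩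
          horner (suc d) (ds₁ ++ v ∷ ds₂)
        ≡⟨ cong (horner (suc d)) (sym split) ⟩
          horner (suc d) ds
        ≡⟨ ds≡q ⟩
          q ∎
        where open ≡-Reasoning

      r-in-R : ∀ k → R (r (suc k))
      r-in-R k with view k
      ... | ‵fromℕ      = r-last
      ... | ‵inject₁ i  = r-mid i

      ys : Fin (suc n) → ℕ
      ys k = c * digits d (row cols k) + r (suc k)

      y-solves : Sol E (λ i → c * stack cols i + r i)
      y-solves = Sol-+ E (λ i → c * stack cols i) r (Sol-scale E c (stack cols) (stack-solves cols)) r-solves

      combine : ∀ i → c * stack cols i + r i ≡ yvec y₁ ys i
      combine zero    = trans (cong₂ (λ h s → c * h + s) first≡q r₀≡r₁) (sym y₁≡)
      combine (suc k) = cong (λ h → c * h + r (suc k)) (stack-row cols k)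

      in-B : ∀ k → InB d c R (ys k)
      in-B k = row cols k , r (suc k) , r-in-R k , refl

      below : ∀ k → ys k < y₁
      below k = subst (ys k <_) (sym y₁≡)
        (quotRem-< c (R<c (r-in-R k))
          (subst (digits d (row cols k) <_) first≡q
            (row-below cols₁ special cols₂ (subst (_< v) (cong bit (sym (snoc-last H true))) 2≤v) k)))

      distinct : Distinct ys
      distinct k k' eq with quotRem-unique c (R<c (r-in-R k)) (R<c (r-in-R k')) eq
      ... | rows≡ , r≡ =
        label-separates H (λ k → r (suc k)) sep-H sep-H-last sep-rest k k'
          (rows-agree-at cols₁ special cols₂ rows≡) r≡

-- Every w < d is a subset sum of d_2,…,d_{m-1}: for w ≤ d − 2 by (ii), and d − 1 is the sum
-- of all of them because d_1 = 1.
subsetSums : ∀ {n} (E : Fin (suc n) → ℕ) → E zero ≡ 1 → ∀ {R c} → 0 < c →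
  (∀ r₁ j → r₁ < c → j + 2 ≤ dsum E → Partition n E R r₁ j) →
  ∀ w → w < dsum E → Σ (Fin n → Bool) λ G → selectSum E G ≡ w
subsetSums {n} E E₀≡1 0<c partition w w<d with w + 2 ≤? dsum E
... | yes room with partition 0 w 0<c room
...   | H , _ , _ , _ , _ , H-sum , _ = H , H-sum
subsetSums {n} E E₀≡1 0<c partition w w<d | no tight = (λ _ → true) , suc-injective (begin
    suc (sumF n (λ i → E (suc i)))      ≡⟨ cong (_+ sumF n (λ i → E (suc i))) (sym E₀≡1) ⟩
    dsum E                              ≡⟨ ≤-antisym d≤1+w w<d ⟩
    suc w                               ∎)
  where
  open ≡-Reasoning
  d≤1+w : dsum E ≤ suc w
  d≤1+w = ≤-pred (subst (dsum E <_) (+-comm w 2) (≰⇒> tight))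

lemma4 : (n : ℕ) (E : Fin (suc n) → ℕ) → Valid E →
    (a : ℕ → ℕ) → IsGreedy E a →
    (z : ℕ) → 1 ≤ z →
    -- (i)  c = 1 + d max(R) - Σ_{k=2}^{m-1} d_k (m-k-1)
    a (suc z) + corr E ≡ 1 + dsum E * a z →
    -- (ii)
    (∀ r₁ j → r₁ < a (suc z) → j + 2 ≤ dsum E →
      Σ (Fin n → Bool) λ H → Σ (Fin (suc (suc n)) → ℕ) λ r →
        (r zero ≡ r₁) ×
        (∀ i → Prefix a z (r (mid i))) × Prefix a z (r (lst n)) ×
        (sumF n (λ i → if H i then E (suc i) else 0) ≡ j) ×
        Sol E r ×
        (∀ i k → H i ≡ true → H k ≡ true → r (mid i) ≡ r (mid k) → i ≡ k) ×
        (∀ i → H i ≡ true → r (mid i) ≢ r (lst n)) ×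
        (∀ i k → H i ≡ false → H k ≡ false → r (mid i) ≡ r (mid k) → i ≡ k)) →
    -- conclusion
    ∀ (y₁ : ℕ) → ¬ InB (dsum E) (a (suc z)) (Prefix a z) y₁ →
      Σ (Fin (suc n) → ℕ) λ ys →
        (∀ i k → ys i ≡ ys k → i ≡ k) ×
        (∀ i → InB (dsum E) (a (suc z)) (Prefix a z) (ys i)) ×
        (∀ i → ys i < y₁) ×
        Σ (Permutation′ (suc (suc n))) λ σ →
          Sol E (λ i → yvec y₁ ys (σ ⟨$⟩ʳ i))
lemma4 n E (_ , _ , E₀≡1 , _) a greedy@(a₀≡0 , increasing , _) z _ _ partition y₁ y₁∉B = conclusion
  where
  open Increasing a increasing
  c d : ℕ
  c = a (suc z)
  d = dsum E
  0<c : 0 < c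
  0<c = ≤-<-trans z≤n (increasing z)

  binaryCase : ∀ {r₁ t} → r₁ < c → y₁ ≡ c * digits d t + r₁ → Completion n E (InB d c (Prefix a z)) y₁
  binaryCase {r₁} {t} r₁<c y₁≡ with locate a₀≡0 z r₁<c
  ... | inj₁ r₁∈R = ⊥-elim (y₁∉B (t , r₁ , r₁∈R , y₁≡))
  ... | inj₂ (k , k≤z , aₖ<r₁ , r₁<aₖ₊₁) = Gap.gapCompletion E a greedy z k k≤z aₖ<r₁ r₁<aₖ₊₁ d c t y₁≡

  conclusion : Completion n E (InB d c (Prefix a z)) y₁
  conclusion with divide y₁ c 0<c
  ... | q , r₁ , r₁<c , y₁≡ with expansion d (weight-positive E E₀≡1) q
  ...   | ds , ds≤d , ds≡q with binary-or-large d ds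
  ...     | inj₁ (t , ds≡t) = binaryCase {t = t} r₁<c (trans y₁≡ (cong (λ h → c * h + r₁) (trans (sym ds≡q) ds≡t)))
  ...     | inj₂ large =
    Columns.largeDigitCompletion E E₀≡1 (subsetSums E E₀≡1 {Prefix a z} 0<c partition) (Prefix a z) c prefix-<
      y₁≡ r₁<c ds ds≤d ds≡q large (λ j room → partition r₁ j r₁<c room)
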